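{- Let $\mathcal{F} \subset \mathcal{P}([n])$ be an $r$-closed $\theta$-intersecting family, where $r \geq 3$ and $\theta \in (0,1)$. If $A \in \mathcal{F}(i)$ is such that $\mathrm{Tor}(A) = \emptyset$, then $\mathcal{F}(i) = \{A\}$.
   Context: A family $\mathcal{F} \subset \mathcal{P}([n])$ is $r$-closed $\theta$-intersecting if for each $2 \leq t \leq r$ and any $t$ distinct sets $A_1,\dots,A_t \in \mathcal{F}$ we have $|A_1 \cap \dots \cap A_t| \in \{\theta|A_1|, \dots, \theta|A_t|\}$. $\mathcal{F}(i) := \mathcal{F} \cap \binom{[n]}{i}$. For $A \in \mathcal{F}$, $\mathrm{Tor}(A) := \{B \in \mathcal{F} : |B| \geq |A|,\ |A \cap B| = \theta|A|\}$.
   Formalization: The parameter θ is rational, ranging over the rationals strictly between 0 and 1. -}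

module Defs where

open import Data.Nat using (ℕ; _≤_; _≥_)
open import Data.Fin using (Fin)
open import Data.Fin.Subset using (Subset; _∩_; ⋂; ∣_∣)
open import Data.List using (tabulate)
open import Data.Integer using (+_)
open import Data.Rational using (ℚ; _/_; _*_)
open import Data.Product using (∃)
open import Relation.Binary.PropositionalEquality using (_≡_)
open import Function.Definitions using (Injective)

toℚ : ℕ → ℚ
toℚ k = (+ k) / 1

_≡θ*_ : ℕ → ℚ → ℕ → Set
(m ≡θ* θ) k = toℚ m ≡ θ * toℚ k

Family : ℕ → Set₁
Family n = Subset n → Set

⋂ᵗ : ∀ {n t} → (Fin t → Subset n) → Subset n
⋂ᵗ As = ⋂ (tabulate As)

RClosedθIntersecting : ∀ {n} → ℕ → ℚ → Family n → Set
RClosedθIntersecting {n} r θ F =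
  ∀ (t : ℕ) → 2 ≤ t → t ≤ r →
  (As : Fin t → Subset n) → Injective _≡_ _≡_ As → (∀ j → F (As j)) →
  ∃ λ (j : Fin t) → (∣ ⋂ᵗ As ∣ ≡θ* θ) ∣ As j ∣

InTor : ∀ {n} → ℚ → Family n → Subset n → Subset n → Set
InTor θ F A B = F B × (∣ B ∣ ≥ ∣ A ∣) × (∣ A ∩ B ∣ ≡θ* θ) ∣ A ∣
  where open import Data.Product using (_×_)

{-# OPTIONS --safe #-}
module Submission where

-- Only the case t = 2 of the closure condition is needed: a set B ≠ A of the
-- same size as A meets A in θ|A| or θ|B| elements, and these agree, so B ∈ Tor(A).
-- Neither the bounds 0 < θ < 1 nor r ≥ 3 (beyond r ≥ 2) play a role.

open import Defs
open import Data.Nat using (ℕ; _≥_; s≤s; z≤n)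
open import Data.Nat.Properties using (≤-reflexive; ≤-trans)
open import Data.Fin using (Fin; zero; suc)
open import Data.Fin.Subset using (Subset; ∣_∣; _∩_)
open import Data.Fin.Subset.Properties using (∩-identityʳ)
open import Data.Rational using (ℚ; 0ℚ; 1ℚ; _<_)
open import Data.Product using (_×_; _,_)
open import Data.Sum using (_⊎_; inj₁; inj₂)
open import Data.Vec.Properties using (≡-dec)
open import Data.Bool.Properties using () renaming (_≟_ to _≟ᵇ_)
open import Data.Empty using (⊥-elim)
open import Function.Definitions using (Injective)
open import Relation.Nullary using (¬_; yes; no)
open import Relation.Binary.PropositionalEquality
  using (_≡_; _≢_; refl; sym; trans; cong; subst)

pair : ∀ {n} → Subset n → Subset n → Fin 2 → Subset n
pair A B zero       = A
pair A B (suc zero) = B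

pair-injective : ∀ {n} {A B : Subset n} → A ≢ B → Injective _≡_ _≡_ (pair A B)
pair-injective A≢B {zero}     {zero}     _   = refl
pair-injective A≢B {zero}     {suc zero} A≡B = ⊥-elim (A≢B A≡B)
pair-injective A≢B {suc zero} {zero}     B≡A = ⊥-elim (A≢B (sym B≡A))
pair-injective A≢B {suc zero} {suc zero} _   = refl

⋂ᵗ-pair : ∀ {n} (A B : Subset n) → ⋂ᵗ (pair A B) ≡ A ∩ B
⋂ᵗ-pair A B = cong (A ∩_) (∩-identityʳ B)

closed⇒pairwise : ∀ {n r θ} {F : Family n} → r ≥ 2 → RClosedθIntersecting r θ F →
  ∀ {A B} → F A → F B → A ≢ B →
  (∣ A ∩ B ∣ ≡θ* θ) ∣ A ∣ ⊎ (∣ A ∩ B ∣ ≡θ* θ) ∣ B ∣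
closed⇒pairwise {θ = θ} {F} r≥2 closed {A} {B} FA FB A≢B
  with closed 2 (s≤s (s≤s z≤n)) r≥2 (pair A B) (pair-injective A≢B) members
  where
  members : ∀ j → F (pair A B j)
  members zero       = FA
  members (suc zero) = FB
... | zero     , p = inj₁ (subst (λ S → (∣ S ∣ ≡θ* θ) ∣ A ∣) (⋂ᵗ-pair A B) p)
... | suc zero , p = inj₂ (subst (λ S → (∣ S ∣ ≡θ* θ) ∣ B ∣) (⋂ᵗ-pair A B) p)

sameSize⇒InTor : ∀ {n r θ} {F : Family n} → r ≥ 2 → RClosedθIntersecting r θ F →
  ∀ {A B} → F A → F B → ∣ B ∣ ≡ ∣ A ∣ → A ≢ B → InTor θ F A B
sameSize⇒InTor {θ = θ} r≥2 closed {A} {B} FA FB |B|≡|A| A≢B =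
  FB , ≤-reflexive (sym |B|≡|A|) , intersection
  where
  intersection : (∣ A ∩ B ∣ ≡θ* θ) ∣ A ∣
  intersection with closed⇒pairwise {θ = θ} r≥2 closed FA FB A≢B
  ... | inj₁ p = p
  ... | inj₂ p = subst (λ k → (∣ A ∩ B ∣ ≡θ* θ) k) |B|≡|A| p

corollary2p6 : (n r : ℕ) (θ : ℚ) (F : Family n) →
    r ≥ 3 → 0ℚ < θ → θ < 1ℚ →
    RClosedθIntersecting r θ F →
    (i : ℕ) (A : Subset n) → F A → ∣ A ∣ ≡ i →
    (∀ B → ¬ InTor θ F A B) →
    ∀ B → ((F B × ∣ B ∣ ≡ i) → B ≡ A) × (B ≡ A → (F B × ∣ B ∣ ≡ i))
corollary2p6 n r θ F r≥3 _ _ closed i A FA |A|≡i noTor B = onlyA , isA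
  where
  isA : B ≡ A → F B × ∣ B ∣ ≡ i
  isA refl = FA , |A|≡i

  onlyA : F B × ∣ B ∣ ≡ i → B ≡ A
  onlyA (FB , |B|≡i) with ≡-dec _≟ᵇ_ B A
  ... | yes B≡A = B≡A
  ... | no  B≢A = ⊥-elim (noTor B (sameSize⇒InTor {θ = θ} (≤-trans (s≤s (s≤s z≤n)) r≥3) closed
                    FA FB (trans |B|≡i (sym |A|≡i)) (λ A≡B → B≢A (sym A≡B))))
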